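{- Let $m\ge 2$, $\mathcal A=\{0,1,\ldots,m-1\}$, and let $\varphi$ be a simple Parry substitution on $\mathcal A$, i.e. $\varphi(\ell)=0^{\alpha_\ell}(\ell+1)$ for $\ell=0,\ldots,m-2$ and $\varphi(m-1)=0^{\alpha_{m-1}}$, where $\alpha_\ell\in\mathbb N\cup\{0\}$, $\alpha_0\ge 1$ and $\alpha_\ell\le\alpha_0$ for all $\ell$. Let $\mathbf u$ be the fixed point of $\varphi$ (starting with $0$), let $U_j=|\varphi^j(0)|$, and let $$R=m-1+\min\{j\,:\,\text{for every }\ell\in\mathcal A,\ \varphi^j(\ell)\text{ has the prefix }0\}.$$ Let $n\in\mathbb N$ and let $K$ be any integer with $n\le U_K$. Put $K_0=\min\{K'\in\mathbb N\cup\{0\}\,:\,n\le U_{K'}\}$. Then $$\mathrm{Dec}\begin{pmatrix}\varphi^{K+R}(0)\\ \mathbf u_{[n]}^{ -1}\varphi^{K+R}(0)\mathbf u_{[n]}\end{pmatrix}=\bigcup_{\ell\in\mathcal A}\mathrm{Dec}\begin{pmatrix}\varphi^{K_0+R-m+1}(\ell)\\ \mathbf u_{[n]}^{ -1}\varphi^{K_0+R-m+1}(\ell)\mathbf u_{[n]}\end{pmatrix}.$$ In particular, the left-hand side does not depend on the choice of $K$ (among integers with $n\le U_K$).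
   Context: $\mathbf u_{[n]}$ denotes the prefix of $\mathbf u$ of length $n$. For words $x,y$ with $x$ a prefix of $y$, $x^{ -1}y$ denotes the word obtained from $y$ by deleting the prefix $x$; so $\mathbf u_{[n]}^{ -1}w\,\mathbf u_{[n]}$ is $w$ with its prefix $\mathbf u_{[n]}$ removed and $\mathbf u_{[n]}$ appended at the end (all words $w$ occurring above have $\mathbf u_{[n]}$ as a prefix). The Parikh vector of a finite word $w$ is $\Psi(w)=(|w|_0,\ldots,|w|_{m-1})$, where $|w|_\ell$ is the number of occurrences of $\ell$ in $w$. For two words $v,w$ with $\Psi(v)=\Psi(w)$, factorize $v=z_0z_1\cdots z_h$, $w=\tilde z_0\tilde z_1\cdots\tilde z_h$ with all $z_j,\tilde z_j$ nonempty and $\Psi(z_j)=\Psi(\tilde z_j)$ for all $j$, choosing $h$ maximal; the abelian co-decomposition $\mathrm{Dec}\binom{v}{w}$ is the set of pairs $\left\{\binom{z_0}{\tilde z_0},\ldots,\binom{z_h}{\tilde z_h}\right\}$. -}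

module Defs where

open import Data.Nat using (ℕ; zero; suc; _+_; _≤_; _<_)
open import Data.Fin using (Fin; zero; suc)
import Data.Fin as Fin
open import Data.List using (List; []; _∷_; _++_; replicate; concatMap; concat; map; length; take; drop; head)
open import Data.Maybe using (Maybe; just; nothing; maybe)
import Data.Maybe as Maybe
open import Data.Vec using (Vec; tabulate)
open import Data.Product using (_×_; Σ; _,_; proj₁; proj₂)
open import Data.List.Relation.Unary.All using (All)
open import Relation.Binary.PropositionalEquality using (_≡_; _≢_)
open import Relation.Nullary using (¬_)

Word : ℕ → Set
Word m = List (Fin m)

next : ∀ {n} → Fin n → Maybe (Fin n)
next {suc zero} zero = nothing
next {suc zero} (suc ())
next {suc (suc n)} zero = just (suc zero)
next {suc (suc n)} (suc i) = Maybe.map suc (next i)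

φ : ∀ {k} → (Fin (suc k) → ℕ) → Fin (suc k) → Word (suc k)
φ α ℓ = replicate (α ℓ) zero ++ maybe (λ x → x ∷ []) [] (next ℓ)

φw : ∀ {k} → (Fin (suc k) → ℕ) → Word (suc k) → Word (suc k)
φw α w = concatMap (φ α) w

φ^ : ∀ {k} → (Fin (suc k) → ℕ) → ℕ → Word (suc k) → Word (suc k)
φ^ α zero w = w
φ^ α (suc j) w = φw α (φ^ α j w)

φ^l : ∀ {k} → (Fin (suc k) → ℕ) → ℕ → Fin (suc k) → Word (suc k)
φ^l α j ℓ = φ^ α j (ℓ ∷ [])

U : ∀ {k} → (Fin (suc k) → ℕ) → ℕ → ℕ
U α j = length (φ^l α j zero)

-- prefix u_[n] of the fixed point u = lim φ^j(0) : φ^j(0) is a prefix of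
-- φ^{j+1}(0) (since α 0 ≥ 1), and it is the prefix of length n of φ^n(0)
-- whenever u has length ≥ n.
uPref : ∀ {k} → (Fin (suc k) → ℕ) → ℕ → Word (suc k)
uPref α n = take n (φ^l α n zero)

rot : ∀ {k} → (Fin (suc k) → ℕ) → ℕ → Word (suc k) → Word (suc k)
rot α n w = drop n w ++ uPref α n

StartsWith0 : ∀ {k} → Word (suc k) → Set
StartsWith0 w = head w ≡ just zero

count : ∀ {m} → Fin m → Word m → ℕ
count ℓ [] = 0
count ℓ (x ∷ w) with ℓ Fin.≟ x
... | Relation.Nullary.yes _ = suc (count ℓ w)
... | Relation.Nullary.no _ = count ℓ w

Ψ : ∀ {m} → Word m → Vec ℕ m
Ψ w = tabulate (λ ℓ → count ℓ w)

Pair : ℕ → Set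
Pair m = Word m × Word m

IsCoFact : ∀ {m} → Word m → Word m → List (Pair m) → Set
IsCoFact v w D =
  All (λ p → (proj₁ p ≢ []) × (proj₂ p ≢ []) × (Ψ (proj₁ p) ≡ Ψ (proj₂ p))) D
  × (concat (map proj₁ D) ≡ v) × (concat (map proj₂ D) ≡ w)

-- a factorization with h maximal; Dec(v,w) is the set of its pairs
IsDec : ∀ {m} → Word m → Word m → List (Pair m) → Set
IsDec v w D = IsCoFact v w D × (∀ D' → IsCoFact v w D' → length D' ≤ length D)

module Submission where

-- Write K + R = (K₀ + j₀) + (K − K₀ + m − 1). Then φ^{K+R}(0) is the concatenation, over the letters ℓ of
-- W = φ^{K−K₀+m−1}(0), of the blocks φ^{K₀+j₀}(ℓ) = φ^{K₀}(0 ⋯). Each block begins with φ^{K₀}(0), hence with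
-- u_[n], so conjugating the whole word by u_[n] conjugates every block by u_[n]. An abelian co-decomposition
-- with h maximal is exactly the factorization into irreducible balanced pairs, which is unique; so the
-- decompositions of the blocks concatenate to that of the whole word. Finally W contains every letter,
-- since ℓ already occurs in φ^ℓ(0).

open import Defs
open import Data.Nat using (ℕ; zero; suc; _+_; _≤_; _<_)
open import Data.Fin using (Fin; zero; suc)
open import Data.List using (List)
open import Data.List.Membership.Propositional using (_∈_)
open import Data.Product using (_×_; Σ; ∃; _,_)
open import Function.Bundles using (_⇔_)
open import Relation.Nullary using (¬_)

open import Data.Fin using (toℕ; inject₁; punchIn)
import Data.Fin as Fin
open import Data.Fin.Properties using (punchInᵢ≢i; toℕ-inject₁; toℕ<n)
open import Data.List using ([]; _∷_; _++_; [_]; take; drop; length; concat; map; concatMap; replicate)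
open import Data.List.Properties
  using (++-assoc; ++-identityʳ; ++-cancelˡ; ++-conicalˡ; ++-conicalʳ; length-++; length-++-≤ˡ; length-take;
         length-drop; take++drop≡id; ∷-injectiveˡ; ∷-injectiveʳ; concatMap-++; concatMap-cong)
open import Data.List.Membership.Propositional using (find; lose)
open import Data.List.Membership.Propositional.Properties using (∈-++⁺ˡ; ∈-++⁺ʳ; ∈-concatMap⁺; ∈-concatMap⁻)
open import Data.List.Relation.Unary.All using (All; []; _∷_)
open import Data.List.Relation.Unary.All.Properties using (++⁺)
open import Data.List.Relation.Unary.Any using (here)
open import Data.Maybe using (just)
import Data.Maybe as Maybe
open import Data.Nat using (_∸_; _≤′_; ≤′-refl; ≤′-step; z≤n; s≤s; s≤s⁻¹; _≤?_; >-nonZero; pred)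
import Data.Nat as ℕ
open import Data.Nat.Induction using (<-wellFounded)
open import Data.Nat.Properties
  using (≤-trans; ≤-reflexive; ≤-<-trans; <⇒≤; <⇒≱; ≮⇒≥; ≤-total; ≤⇒≤′; m≤n+m; +-comm; +-cancelˡ-≡; n≮n;
         +-mono-≤; m∸n≡0⇒m≤n; m<m+n; m≤n⇒m⊓n≡m; m∸n+n≡m; ∸-monoʳ-<; suc-pred; suc-injective; anyUpTo?;
         +-0-commutativeMonoid)
open import Data.Nat.Solver using (module +-*-Solver)
open import Data.Product using (proj₁; proj₂)
open import Data.Sum using (inj₁; inj₂)
open import Data.Vec using (lookup)
open import Data.Vec.Properties using (lookup∘tabulate; tabulate-cong; ≡-dec)
open import Algebra.Properties.CommutativeMonoid.Sum +-0-commutativeMonoid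
  using (sum-syntax; sum-remove; sum-cong-≗; sum-replicate-zero; ∑-distrib-+)
open import Function using (_∘_; case_of_)
open import Function.Bundles using (mk⇔)
open import Induction.WellFounded using (Acc; acc)
open import Relation.Nullary using (Dec; yes; no; contradiction)
open import Relation.Nullary.Decidable using (_×-dec_)
open import Relation.Binary.PropositionalEquality
  using (_≡_; _≢_; refl; sym; trans; cong; cong₂; subst; subst₂; module ≡-Reasoning)

open +-*-Solver using (solve; _:+_; _:=_)

open ≡-Reasoning

module _ {A : Set} where

  ≢[]⇒0<length : {xs : List A} → xs ≢ [] → 0 < length xs
  ≢[]⇒0<length {[]} xs≢[] = contradiction refl xs≢[]
  ≢[]⇒0<length {_ ∷ _} _ = s≤s z≤n

  length≡0⇒≡[] : {xs : List A} → length xs ≡ 0 → xs ≡ []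
  length≡0⇒≡[] {[]} _ = refl

  take-length-++ : ∀ (xs ys : List A) → take (length xs) (xs ++ ys) ≡ xs
  take-length-++ [] ys = refl
  take-length-++ (x ∷ xs) ys = cong (x ∷_) (take-length-++ xs ys)

  drop-length-++ : ∀ (xs ys : List A) → drop (length xs) (xs ++ ys) ≡ ys
  drop-length-++ [] ys = refl
  drop-length-++ (x ∷ xs) ys = drop-length-++ xs ys

  take-++-≤ : ∀ n (xs ys : List A) → n ≤ length xs → take n (xs ++ ys) ≡ take n xs
  take-++-≤ zero xs ys _ = refl
  take-++-≤ (suc n) (x ∷ xs) ys (s≤s n≤∣xs∣) = cong (x ∷_) (take-++-≤ n xs ys n≤∣xs∣)

  ++-prefix-≡ : ∀ (xs us ys vs : List A) → length xs ≡ length ys → xs ++ us ≡ ys ++ vs → xs ≡ ys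
  ++-prefix-≡ [] us [] vs _ _ = refl
  ++-prefix-≡ (x ∷ xs) us (y ∷ ys) vs ∣xs∣≡∣ys∣ eq =
    cong₂ _∷_ (∷-injectiveˡ eq) (++-prefix-≡ xs us ys vs (suc-injective ∣xs∣≡∣ys∣) (∷-injectiveʳ eq))

  ++-prefix-≤ : ∀ (xs us ys vs : List A) → length xs ≤ length ys → xs ++ us ≡ ys ++ vs → ∃ λ e → ys ≡ xs ++ e
  ++-prefix-≤ [] us ys vs _ _ = ys , refl
  ++-prefix-≤ (x ∷ xs) us (y ∷ ys) vs (s≤s ∣xs∣≤∣ys∣) eq with ++-prefix-≤ xs us ys vs ∣xs∣≤∣ys∣ (∷-injectiveʳ eq)
  ... | e , ys≡xs++e = e , cong₂ _∷_ (sym (∷-injectiveˡ eq)) ys≡xs++e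

  rotate-concatMap : ∀ {B : Set} (P : List A) (b : B → List A) {xs : List B} → xs ≢ [] →
    drop (length P) (concatMap (λ y → P ++ b y) xs) ++ P ≡ concatMap (λ y → b y ++ P) xs
  rotate-concatMap P b {[]} []≢[] = contradiction refl []≢[]
  rotate-concatMap P b {x ∷ xs} _ = begin
    drop (length P) ((P ++ b x) ++ C) ++ P ≡⟨ cong (λ w → drop (length P) w ++ P) (++-assoc P (b x) C) ⟩
    drop (length P) (P ++ b x ++ C) ++ P   ≡⟨ cong (_++ P) (drop-length-++ P (b x ++ C)) ⟩
    (b x ++ C) ++ P                        ≡⟨ ++-assoc (b x) C P ⟩
    b x ++ C ++ P                          ≡⟨ cong (b x ++_) (shift xs) ⟩
    b x ++ P ++ C′                         ≡⟨ ++-assoc (b x) P C′ ⟨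
    (b x ++ P) ++ C′                       ∎
    where
    C C′ : List A
    C = concatMap (λ y → P ++ b y) xs
    C′ = concatMap (λ y → b y ++ P) xs
    shift : ∀ ys → concatMap (λ y → P ++ b y) ys ++ P ≡ P ++ concatMap (λ y → b y ++ P) ys
    shift [] = sym (++-identityʳ P)
    shift (y ∷ ys) = begin
      ((P ++ b y) ++ D) ++ P   ≡⟨ ++-assoc (P ++ b y) D P ⟩
      (P ++ b y) ++ D ++ P     ≡⟨ cong ((P ++ b y) ++_) (shift ys) ⟩
      (P ++ b y) ++ P ++ D′    ≡⟨ ++-assoc P (b y) (P ++ D′) ⟩
      P ++ b y ++ P ++ D′      ≡⟨ cong (P ++_) (++-assoc (b y) P D′) ⟨
      P ++ (b y ++ P) ++ D′    ∎
      where
      D D′ : List A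
      D = concatMap (λ y → P ++ b y) ys
      D′ = concatMap (λ y → b y ++ P) ys

  ∈-concatMap⇔ : ∀ {B : Set} (f : B → List A) {xs : List B} {y} →
    (∀ x → x ∈ xs) → y ∈ concatMap f xs ⇔ (∃ λ x → y ∈ f x)
  ∈-concatMap⇔ f {xs} every∈ = mk⇔
    (λ y∈ → let (x , _ , y∈fx) = find (∈-concatMap⁻ f {xs} y∈) in x , y∈fx)
    (λ (x , y∈fx) → ∈-concatMap⁺ f (lose (every∈ x) y∈fx))

module _ {m : ℕ} where

  count-∷ : ∀ (ℓ x : Fin m) w → count ℓ (x ∷ w) ≡ count ℓ [ x ] + count ℓ w
  count-∷ ℓ x w with ℓ Fin.≟ x
  ... | yes _ = refl
  ... | no _ = refl

  count-++ : ∀ ℓ (u v : Word m) → count ℓ (u ++ v) ≡ count ℓ u + count ℓ v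
  count-++ ℓ [] v = refl
  count-++ ℓ (x ∷ u) v with ℓ Fin.≟ x
  ... | yes _ = cong suc (count-++ ℓ u v)
  ... | no _ = count-++ ℓ u v

  count-[x]-self : ∀ (x : Fin m) → count x [ x ] ≡ 1
  count-[x]-self x with x Fin.≟ x
  ... | yes _ = refl
  ... | no x≢x = contradiction refl x≢x

  count-[x]-other : ∀ {ℓ x : Fin m} → ℓ ≢ x → count ℓ [ x ] ≡ 0
  count-[x]-other {ℓ} {x} ℓ≢x with ℓ Fin.≟ x
  ... | yes ℓ≡x = contradiction ℓ≡x ℓ≢x
  ... | no _ = refl

∑-count-[_] : ∀ {m} (x : Fin (suc m)) → ∑[ ℓ < suc m ] count ℓ [ x ] ≡ 1
∑-count-[_] {m} x = begin
  ∑[ ℓ < suc m ] count ℓ [ x ]                           ≡⟨ sum-remove {i = x} (λ ℓ → count ℓ [ x ]) ⟩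
  count x [ x ] + ∑[ j < m ] count (punchIn x j) [ x ]   ≡⟨ cong₂ _+_ (count-[x]-self x)
                                                              (sum-cong-≗ (count-[x]-other ∘ punchInᵢ≢i x)) ⟩
  1 + ∑[ j < m ] 0                                       ≡⟨ cong suc (sum-replicate-zero m) ⟩
  1                                                      ∎

length≡∑count : ∀ {m} (w : Word m) → length w ≡ ∑[ ℓ < m ] count ℓ w
length≡∑count {m} [] = sym (sum-replicate-zero m)
length≡∑count {suc m} (x ∷ w) = begin
  1 + length w                                           ≡⟨ cong₂ _+_ (sym ∑-count-[ x ]) (length≡∑count w) ⟩
  ∑[ ℓ < suc m ] count ℓ [ x ] + ∑[ ℓ < suc m ] count ℓ w ≡⟨ ∑-distrib-+ (λ ℓ → count ℓ [ x ]) (λ ℓ → count ℓ w) ⟨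
  ∑[ ℓ < suc m ] (count ℓ [ x ] + count ℓ w)             ≡⟨ sum-cong-≗ (λ ℓ → count-∷ ℓ x w) ⟨
  ∑[ ℓ < suc m ] count ℓ (x ∷ w)                         ∎

module _ {m : ℕ} where

  -- Abelian equivalence: equal Parikh vectors, kept letterwise so that both words stay inferable.
  infix 4 _∼_
  record _∼_ (u v : Word m) : Set where
    constructor mk∼
    field count-≡ : ∀ ℓ → count ℓ u ≡ count ℓ v
  open _∼_

  Ψ≡⇒∼ : ∀ {u v : Word m} → Ψ u ≡ Ψ v → u ∼ v
  Ψ≡⇒∼ {u} {v} Ψu≡Ψv = mk∼ λ ℓ → begin
    count ℓ u                             ≡⟨ lookup∘tabulate (λ i → count i u) ℓ ⟨
    lookup (Ψ u) ℓ                        ≡⟨ cong (λ c → lookup c ℓ) Ψu≡Ψv ⟩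
    lookup (Ψ v) ℓ                        ≡⟨ lookup∘tabulate (λ i → count i v) ℓ ⟩
    count ℓ v                             ∎

  ∼⇒Ψ≡ : ∀ {u v : Word m} → u ∼ v → Ψ u ≡ Ψ v
  ∼⇒Ψ≡ u∼v = tabulate-cong (count-≡ u∼v)

  ∼-cancelˡ : ∀ {u ũ v ṽ : Word m} → u ++ v ∼ ũ ++ ṽ → u ∼ ũ → v ∼ ṽ
  ∼-cancelˡ {u} {ũ} {v} {ṽ} uv∼ũṽ u∼ũ = mk∼ λ ℓ → +-cancelˡ-≡ (count ℓ u) _ _ (begin
    count ℓ u + count ℓ v                 ≡⟨ count-++ ℓ u v ⟨
    count ℓ (u ++ v)                      ≡⟨ count-≡ uv∼ũṽ ℓ ⟩
    count ℓ (ũ ++ ṽ)                      ≡⟨ count-++ ℓ ũ ṽ ⟩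
    count ℓ ũ + count ℓ ṽ                 ≡⟨ cong (_+ count ℓ ṽ) (count-≡ u∼ũ ℓ) ⟨
    count ℓ u + count ℓ ṽ                 ∎)

  ∼-++-comm : ∀ (u v : Word m) → u ++ v ∼ v ++ u
  ∼-++-comm u v = mk∼ λ ℓ → begin
    count ℓ (u ++ v)                      ≡⟨ count-++ ℓ u v ⟩
    count ℓ u + count ℓ v                 ≡⟨ +-comm (count ℓ u) (count ℓ v) ⟩
    count ℓ v + count ℓ u                 ≡⟨ count-++ ℓ v u ⟨
    count ℓ (v ++ u)                      ∎

  ∼⇒length≡ : ∀ {u v : Word m} → u ∼ v → length u ≡ length v
  ∼⇒length≡ {u} {v} u∼v = begin
    length u                              ≡⟨ length≡∑count u ⟩
    ∑[ ℓ < m ] count ℓ u                  ≡⟨ sum-cong-≗ (count-≡ u∼v) ⟩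
    ∑[ ℓ < m ] count ℓ v                  ≡⟨ length≡∑count v ⟨
    length v                              ∎

  ∼-≢[] : ∀ {u v : Word m} → u ∼ v → u ≢ [] → v ≢ []
  ∼-≢[] u∼v u≢[] v≡[] = u≢[] (length≡0⇒≡[] (trans (∼⇒length≡ u∼v) (cong length v≡[])))

module _ {m : ℕ} where

  private
    variable
      v w v′ w′ : Word m
      D E : List (Pair m)

  upper lower : List (Pair m) → Word m
  upper D = concat (map proj₁ D)
  lower D = concat (map proj₂ D)

  Balanced : Pair m → Set
  Balanced p = proj₁ p ≢ [] × proj₂ p ≢ [] × Ψ (proj₁ p) ≡ Ψ (proj₂ p)

  Irreducible : Pair m → Set
  Irreducible p = ∀ {x y x̃ ỹ : Word m} → x ≢ [] → y ≢ [] → proj₁ p ≡ x ++ y → proj₂ p ≡ x̃ ++ ỹ → ¬ x ∼ x̃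

  IsIrreducibleCoFact : Word m → Word m → List (Pair m) → Set
  IsIrreducibleCoFact v w D = IsCoFact v w D × All Irreducible D

  balanced-of-∼ : ∀ {u v : Word m} → u ≢ [] → u ∼ v → Balanced (u , v)
  balanced-of-∼ u≢[] u∼v = u≢[] , ∼-≢[] u∼v u≢[] , ∼⇒Ψ≡ u∼v

  IsCoFact-++ : IsCoFact v w D → IsCoFact v′ w′ E → IsCoFact (v ++ v′) (w ++ w′) (D ++ E)
  IsCoFact-++ {D = D} {E = E} (bs , refl , refl) (bs′ , refl , refl) =
    ++⁺ bs bs′ , concatMap-++ proj₁ D E , concatMap-++ proj₂ D E

  IsIrreducibleCoFact-++ : IsIrreducibleCoFact v w D → IsIrreducibleCoFact v′ w′ E →
    IsIrreducibleCoFact (v ++ v′) (w ++ w′) (D ++ E)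
  IsIrreducibleCoFact-++ (f , irr) (f′ , irr′) = IsCoFact-++ f f′ , ++⁺ irr irr′

  -- If the shorter head were a proper prefix of the irreducible one, it would split it.
  irreducible-head : ∀ {z₁ z̃₁ z₂ z̃₂ r₁ r̃₁ r₂ r̃₂ : Word m} →
    Balanced (z₁ , z̃₁) → Balanced (z₂ , z̃₂) → Irreducible (z₂ , z̃₂) → length z₁ ≤ length z₂ →
    z₁ ++ r₁ ≡ z₂ ++ r₂ → z̃₁ ++ r̃₁ ≡ z̃₂ ++ r̃₂ → (z₁ , z̃₁) ≡ (z₂ , z̃₂)
  irreducible-head {z₁} {z̃₁} {z₂} {z̃₂} {r₁} {r̃₁} {r₂} {r̃₂} (z₁≢[] , _ , Ψ₁) (_ , _ , Ψ₂) irr ∣z₁∣≤∣z₂∣ eq eq̃ =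
    heads (++-prefix-≤ z₁ r₁ z₂ r₂ ∣z₁∣≤∣z₂∣ eq)
    where
    z₁∼z̃₁ : z₁ ∼ z̃₁
    z₁∼z̃₁ = Ψ≡⇒∼ Ψ₁
    z₂∼z̃₂ : z₂ ∼ z̃₂
    z₂∼z̃₂ = Ψ≡⇒∼ Ψ₂
    ∣z̃₁∣≤∣z̃₂∣ : length z̃₁ ≤ length z̃₂
    ∣z̃₁∣≤∣z̃₂∣ = subst₂ _≤_ (∼⇒length≡ z₁∼z̃₁) (∼⇒length≡ z₂∼z̃₂) ∣z₁∣≤∣z₂∣
    heads : (∃ λ e → z₂ ≡ z₁ ++ e) → (z₁ , z̃₁) ≡ (z₂ , z̃₂)
    heads ([] , z₂≡z₁++[]) = cong₂ _,_ z₁≡z₂ (++-prefix-≡ z̃₁ r̃₁ z̃₂ r̃₂ ∣z̃₁∣≡∣z̃₂∣ eq̃)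
      where
      z₁≡z₂ : z₁ ≡ z₂
      z₁≡z₂ = sym (trans z₂≡z₁++[] (++-identityʳ z₁))
      ∣z̃₁∣≡∣z̃₂∣ : length z̃₁ ≡ length z̃₂
      ∣z̃₁∣≡∣z̃₂∣ = begin
        length z̃₁   ≡⟨ ∼⇒length≡ z₁∼z̃₁ ⟨
        length z₁   ≡⟨ cong length z₁≡z₂ ⟩
        length z₂   ≡⟨ ∼⇒length≡ z₂∼z̃₂ ⟩
        length z̃₂   ∎
    heads (_ ∷ _ , z₂≡z₁++e) with ++-prefix-≤ z̃₁ r̃₁ z̃₂ r̃₂ ∣z̃₁∣≤∣z̃₂∣ eq̃
    ... | _ , z̃₂≡z̃₁++ẽ = contradiction z₁∼z̃₁ (irr z₁≢[] (λ ()) z₂≡z₁++e z̃₂≡z̃₁++ẽ)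

  irreducibleCoFact-unique : IsIrreducibleCoFact v w D → IsIrreducibleCoFact v w E → D ≡ E
  irreducibleCoFact-unique {D = []} {[]} _ _ = refl
  irreducibleCoFact-unique {D = []} {(z , _) ∷ E} ((_ , refl , _) , _) (((z≢[] , _) ∷ _ , up , _) , _) =
    contradiction (++-conicalˡ z (upper E) up) z≢[]
  irreducibleCoFact-unique {D = (z , _) ∷ D} {[]} (((z≢[] , _) ∷ _ , up , _) , _) ((_ , refl , _) , _) =
    contradiction (++-conicalˡ z (upper D) up) z≢[]
  irreducibleCoFact-unique {D = p ∷ D} {q ∷ E} ((b ∷ bs , refl , refl) , i ∷ is) ((b′ ∷ bs′ , up , lo) , i′ ∷ is′)
    with heads-equal
    where
    heads-equal : p ≡ q
    heads-equal with ≤-total (length (proj₁ p)) (length (proj₁ q))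
    ... | inj₁ ∣p∣≤∣q∣ = irreducible-head b b′ i′ ∣p∣≤∣q∣ (sym up) (sym lo)
    ... | inj₂ ∣q∣≤∣p∣ = sym (irreducible-head b′ b i ∣q∣≤∣p∣ up lo)
  ... | refl = cong (p ∷_) (irreducibleCoFact-unique ((bs , refl , refl) , is)
                 ((bs′ , ++-cancelˡ (proj₁ p) _ _ up , ++-cancelˡ (proj₂ p) _ _ lo) , is′))

  maximal⇒irreducible : IsCoFact v w D →
    (∀ D′ → IsCoFact v w D′ → length D′ ≤ length D) → All Irreducible D
  maximal⇒irreducible {D = []} _ _ = []
  maximal⇒irreducible {D = (z , z̃) ∷ D} (b@(_ , _ , Ψz) ∷ bs , refl , refl) maximal =
    head-irreducible ∷ maximal⇒irreducible (bs , refl , refl) tail-maximal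
    where
    head-irreducible : Irreducible (z , z̃)
    head-irreducible {x} {y} {x̃} {ỹ} x≢[] y≢[] z≡x++y z̃≡x̃++ỹ x∼x̃ =
      n≮n (length D) (s≤s⁻¹ (maximal ((x , x̃) ∷ (y , ỹ) ∷ D) (split , upper-split , lower-split)))
      where
      y∼ỹ : y ∼ ỹ
      y∼ỹ = ∼-cancelˡ (subst₂ _∼_ z≡x++y z̃≡x̃++ỹ (Ψ≡⇒∼ Ψz)) x∼x̃
      split : All Balanced ((x , x̃) ∷ (y , ỹ) ∷ D)
      split = balanced-of-∼ x≢[] x∼x̃ ∷ balanced-of-∼ y≢[] y∼ỹ ∷ bs
      upper-split : x ++ y ++ upper D ≡ z ++ upper D
      upper-split = trans (sym (++-assoc x y (upper D))) (cong (_++ upper D) (sym z≡x++y))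
      lower-split : x̃ ++ ỹ ++ lower D ≡ z̃ ++ lower D
      lower-split = trans (sym (++-assoc x̃ ỹ (lower D))) (cong (_++ lower D) (sym z̃≡x̃++ỹ))
    tail-maximal : ∀ D′ → IsCoFact (upper D) (lower D) D′ → length D′ ≤ length D
    tail-maximal D′ (bs′ , up , lo) =
      s≤s⁻¹ (maximal ((z , z̃) ∷ D′) (b ∷ bs′ , cong (z ++_) up , cong (z̃ ++_) lo))

  BalancedPrefix : Word m → Word m → ℕ → Set
  BalancedPrefix z z̃ i = 1 ≤ i × Ψ (take i z) ≡ Ψ (take i z̃)

  balancedPrefix? : ∀ z z̃ i → Dec (BalancedPrefix z z̃ i)
  balancedPrefix? z z̃ i = 1 ≤? i ×-dec ≡-dec ℕ._≟_ (Ψ (take i z)) (Ψ (take i z̃))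

  irreducible-if-no-balanced-prefix : ∀ {z z̃ : Word m} →
    ¬ (∃ λ i → i < length z × BalancedPrefix z z̃ i) → Irreducible (z , z̃)
  irreducible-if-no-balanced-prefix none {x} {y} {x̃} {ỹ} x≢[] y≢[] refl refl x∼x̃ =
    none (length x , ∣x∣<∣x++y∣ , ≢[]⇒0<length x≢[] , Ψ-take)
    where
    ∣x∣<∣x++y∣ : length x < length (x ++ y)
    ∣x∣<∣x++y∣ = subst (length x <_) (sym (length-++ x)) (m<m+n (length x) (≢[]⇒0<length y≢[]))
    Ψ-take : Ψ (take (length x) (x ++ y)) ≡ Ψ (take (length x) (x̃ ++ ỹ))
    Ψ-take = begin
      Ψ (take (length x) (x ++ y))    ≡⟨ cong Ψ (take-length-++ x y) ⟩
      Ψ x                             ≡⟨ ∼⇒Ψ≡ x∼x̃ ⟩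
      Ψ x̃                             ≡⟨ cong Ψ (take-length-++ x̃ ỹ) ⟨
      Ψ (take (length x̃) (x̃ ++ ỹ))    ≡⟨ cong (λ i → Ψ (take i (x̃ ++ ỹ))) (∼⇒length≡ x∼x̃) ⟨
      Ψ (take (length x) (x̃ ++ ỹ))    ∎

  -- Cut at a balanced proper prefix while there is one; the length of the upper word decreases.
  refine-balanced : ∀ {z z̃ : Word m} → Acc _<_ (length z) → Balanced (z , z̃) →
    ∃ λ E → IsIrreducibleCoFact z z̃ E × 0 < length E
  refine-balanced {z} {z̃} (acc rec) b@(_ , _ , Ψz) with anyUpTo? (balancedPrefix? z z̃) (length z)
  ... | no none = [ (z , z̃) ] ,
    ((b ∷ [] , ++-identityʳ z , ++-identityʳ z̃) , irreducible-if-no-balanced-prefix none ∷ []) , s≤s z≤n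
  ... | yes (i , i<∣z∣ , 1≤i , Ψ≡) =
    let (E₁ , f₁ , 0<∣E₁∣) = refine-balanced (rec ∣take∣<∣z∣) (balanced-of-∼ take≢[] x∼x̃)
        (E₂ , f₂ , _) = refine-balanced (rec ∣drop∣<∣z∣) (balanced-of-∼ drop≢[] y∼ỹ)
    in E₁ ++ E₂ ,
       subst₂ (λ u ũ → IsIrreducibleCoFact u ũ (E₁ ++ E₂)) (take++drop≡id i z) (take++drop≡id i z̃)
         (IsIrreducibleCoFact-++ f₁ f₂) ,
       ≤-trans 0<∣E₁∣ (length-++-≤ˡ E₁)
    where
    x∼x̃ : take i z ∼ take i z̃
    x∼x̃ = Ψ≡⇒∼ Ψ≡
    y∼ỹ : drop i z ∼ drop i z̃
    y∼ỹ = ∼-cancelˡ (subst₂ _∼_ (sym (take++drop≡id i z)) (sym (take++drop≡id i z̃)) (Ψ≡⇒∼ Ψz)) x∼x̃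
    ∣take∣≡i : length (take i z) ≡ i
    ∣take∣≡i = trans (length-take i z) (m≤n⇒m⊓n≡m (<⇒≤ i<∣z∣))
    ∣take∣<∣z∣ : length (take i z) < length z
    ∣take∣<∣z∣ = subst (_< length z) (sym ∣take∣≡i) i<∣z∣
    ∣drop∣<∣z∣ : length (drop i z) < length z
    ∣drop∣<∣z∣ = subst (_< length z) (sym (length-drop i z)) (∸-monoʳ-< 1≤i (<⇒≤ i<∣z∣))
    take≢[] : take i z ≢ []
    take≢[] eq = <⇒≱ 1≤i (≤-reflexive (trans (sym ∣take∣≡i) (cong length eq)))
    drop≢[] : drop i z ≢ []
    drop≢[] eq = <⇒≱ i<∣z∣ (m∸n≡0⇒m≤n (trans (sym (length-drop i z)) (cong length eq)))

  refine-coFact : IsCoFact v w D → ∃ λ E → IsIrreducibleCoFact v w E × length D ≤ length E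
  refine-coFact {D = []} f = [] , (f , []) , z≤n
  refine-coFact {D = (z , z̃) ∷ D} (b ∷ bs , refl , refl) =
    let (E₁ , f₁ , 0<∣E₁∣) = refine-balanced (<-wellFounded (length z)) b
        (E₂ , f₂ , ∣D∣≤∣E₂∣) = refine-coFact (bs , refl , refl)
    in E₁ ++ E₂ , IsIrreducibleCoFact-++ f₁ f₂ ,
       subst (suc (length D) ≤_) (sym (length-++ E₁)) (+-mono-≤ 0<∣E₁∣ ∣D∣≤∣E₂∣)

  irreducible⇒isDec : IsIrreducibleCoFact v w D → IsDec v w D
  irreducible⇒isDec (f , irr) = f , λ D′ f′ →
    let (E , g , ∣D′∣≤∣E∣) = refine-coFact f′
    in subst (λ F → length D′ ≤ length F) (irreducibleCoFact-unique g (f , irr)) ∣D′∣≤∣E∣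

  isDec⇒irreducible : IsDec v w D → IsIrreducibleCoFact v w D
  isDec⇒irreducible (f , maximal) = f , maximal⇒irreducible f maximal

  isDec-exists : v ∼ w → ∃ (IsDec v w)
  isDec-exists {[]} []∼w = [] , irreducible⇒isDec (([] , refl , sym (length≡0⇒≡[] (sym (∼⇒length≡ []∼w)))) , [])
  isDec-exists {_ ∷ _} v∼w =
    let (E , f , _) = refine-balanced (<-wellFounded _) (balanced-of-∼ (λ ()) v∼w) in E , irreducible⇒isDec f

  isDec-unique : IsDec v w D → IsDec v w E → D ≡ E
  isDec-unique d d′ = irreducibleCoFact-unique (isDec⇒irreducible d) (isDec⇒irreducible d′)

  isDec-concatMap : ∀ {B : Set} {f g : B → Word m} {Dx : B → List (Pair m)} (xs : List B) →
    (∀ x → IsDec (f x) (g x) (Dx x)) → IsDec (concatMap f xs) (concatMap g xs) (concatMap Dx xs)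
  isDec-concatMap {f = f} {g} {Dx} xs d = irreducible⇒isDec (irreducible-concatMap xs)
    where
    irreducible-concatMap : ∀ xs → IsIrreducibleCoFact (concatMap f xs) (concatMap g xs) (concatMap Dx xs)
    irreducible-concatMap [] = ([] , refl , refl) , []
    irreducible-concatMap (x ∷ xs) = IsIrreducibleCoFact-++ (isDec⇒irreducible (d x)) (irreducible-concatMap xs)

startsWith0⇒∷ : ∀ {k} {w : Word (suc k)} → StartsWith0 w → ∃ λ r → w ≡ zero ∷ r
startsWith0⇒∷ {w = x ∷ r} refl = r , refl

next-inject₁ : ∀ {k} (i : Fin (suc k)) → next {suc (suc k)} (inject₁ i) ≡ just (suc i)
next-inject₁ zero = refl
next-inject₁ {suc k} (suc i) = cong (Maybe.map suc) (next-inject₁ i)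

module _ {k : ℕ} (α : Fin (suc k) → ℕ) where

  φ^-[] : ∀ j → φ^ α j [] ≡ []
  φ^-[] zero = refl
  φ^-[] (suc j) = cong (φw α) (φ^-[] j)

  φ^-++ : ∀ j (u v : Word (suc k)) → φ^ α j (u ++ v) ≡ φ^ α j u ++ φ^ α j v
  φ^-++ zero u v = refl
  φ^-++ (suc j) u v = trans (cong (φw α) (φ^-++ j u v)) (concatMap-++ (φ α) (φ^ α j u) (φ^ α j v))

  φ^-+ : ∀ i j (w : Word (suc k)) → φ^ α (i + j) w ≡ φ^ α i (φ^ α j w)
  φ^-+ zero j w = refl
  φ^-+ (suc i) j w = cong (φw α) (φ^-+ i j w)

  φ^-concatMap : ∀ j (w : Word (suc k)) → φ^ α j w ≡ concatMap (φ^l α j) w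
  φ^-concatMap j [] = φ^-[] j
  φ^-concatMap j (x ∷ w) = trans (φ^-++ j [ x ] w) (cong (φ^l α j x ++_) (φ^-concatMap j w))

  ∈-φw : ∀ {x y} (w : Word (suc k)) → x ∈ w → next x ≡ just y → y ∈ φw α w
  ∈-φw w x∈w next[x]≡y = ∈-concatMap⁺ (φ α) (lose x∈w (∈-φ next[x]≡y))
    where
    ∈-φ : ∀ {x y} → next x ≡ just y → y ∈ φ α x
    ∈-φ {x} eq with next x | eq
    ... | just _ | refl = ∈-++⁺ʳ (replicate (α x) zero) (here refl)

module _ {k : ℕ} (α : Fin (suc (suc k)) → ℕ) (α₀≥1 : 1 ≤ α zero) where

  φ-zero-tail : Word (suc (suc k))
  φ-zero-tail = replicate (pred (α zero)) zero ++ [ suc zero ]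

  φ-zero : φ α zero ≡ zero ∷ φ-zero-tail
  φ-zero = cong (λ a → replicate a zero ++ [ suc zero ]) (sym (suc-pred (α zero) ⦃ >-nonZero α₀≥1 ⦄))

  φ^-zero-∷ : ∀ j (w : Word (suc (suc k))) → ∃ λ t → φ^ α j (zero ∷ w) ≡ zero ∷ t
  φ^-zero-∷ zero w = w , refl
  φ^-zero-∷ (suc j) w =
    let (t , φʲ≡0∷t) = φ^-zero-∷ j w
    in φ-zero-tail ++ φw α t , trans (cong (φw α) φʲ≡0∷t) (cong (_++ φw α t) φ-zero)

  φ^l-zero-suc : ∀ j → φ^l α (suc j) zero ≡ φ^l α j zero ++ φ^ α j φ-zero-tail
  φ^l-zero-suc j = begin
    φ^ α (suc j) [ zero ]                ≡⟨ cong (λ i → φ^ α i [ zero ]) (+-comm 1 j) ⟩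
    φ^ α (j + 1) [ zero ]                ≡⟨ φ^-+ α j 1 [ zero ] ⟩
    φ^ α j (φ α zero ++ [])              ≡⟨ cong (φ^ α j) (trans (++-identityʳ (φ α zero)) φ-zero) ⟩
    φ^ α j (zero ∷ φ-zero-tail)          ≡⟨ φ^-++ α j [ zero ] φ-zero-tail ⟩
    φ^l α j zero ++ φ^ α j φ-zero-tail   ∎

  φ^l-zero-prefix : ∀ {i j} → i ≤ j → ∃ λ t → φ^l α j zero ≡ φ^l α i zero ++ t
  φ^l-zero-prefix = prefix′ ∘ ≤⇒≤′
    where
    prefix′ : ∀ {i j} → i ≤′ j → ∃ λ t → φ^l α j zero ≡ φ^l α i zero ++ t
    prefix′ {i} ≤′-refl = [] , sym (++-identityʳ (φ^l α i zero))
    prefix′ {i} (≤′-step {j} i≤′j) =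
      let (t , eq) = prefix′ i≤′j
      in t ++ φ^ α j φ-zero-tail ,
         trans (φ^l-zero-suc j) (trans (cong (_++ φ^ α j φ-zero-tail) eq) (++-assoc (φ^l α i zero) t _))

  uPref≡take : ∀ {K n} → K ≤ n → n ≤ U α K → uPref α n ≡ take n (φ^l α K zero)
  uPref≡take {K} {n} K≤n n≤U[K] =
    let (t , eq) = φ^l-zero-prefix K≤n
    in trans (cong (take n) eq) (take-++-≤ n (φ^l α K zero) t n≤U[K])

  ∈-φ^l-zero : ∀ {ℓ j} → toℕ ℓ ≤ j → ℓ ∈ φ^l α j zero
  ∈-φ^l-zero {ℓ} ℓ≤j =
    let (t , eq) = φ^l-zero-prefix ℓ≤j
    in subst (ℓ ∈_) (sym eq) (∈-++⁺ˡ (∈-φ^l-zero-toℕ ℓ refl))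
    where
    ∈-φ^l-zero-toℕ : ∀ {n} (ℓ : Fin (suc (suc k))) → toℕ ℓ ≡ n → ℓ ∈ φ^l α n zero
    ∈-φ^l-zero-toℕ {zero} zero _ = here refl
    ∈-φ^l-zero-toℕ {suc n} (suc i) eq =
      ∈-φw α (φ^l α n zero) (∈-φ^l-zero-toℕ (inject₁ i) (trans (toℕ-inject₁ i) (suc-injective eq))) (next-inject₁ i)

  module _ (j₀ : ℕ) (starts₀ : ∀ ℓ → StartsWith0 (φ^l α j₀ ℓ)) where

    -- φ^{j₀} φ^j (ℓ) = φ^j φ^{j₀} (ℓ) starts with 0, whereas φ^{j₀} [] = [].
    φ^l-≢[] : ∀ j ℓ → φ^l α j ℓ ≢ []
    φ^l-≢[] j ℓ φʲℓ≡[] =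
      let (r , φʲ⁰ℓ≡0∷r) = startsWith0⇒∷ (starts₀ ℓ)
          (t , φʲ0∷r≡0∷t) = φ^-zero-∷ j r
          0∷t≡[] : zero ∷ t ≡ []
          0∷t≡[] = begin
            zero ∷ t                ≡⟨ φʲ0∷r≡0∷t ⟨
            φ^ α j (zero ∷ r)       ≡⟨ cong (φ^ α j) φʲ⁰ℓ≡0∷r ⟨
            φ^ α j (φ^l α j₀ ℓ)     ≡⟨ φ^-+ α j j₀ [ ℓ ] ⟨
            φ^l α (j + j₀) ℓ        ≡⟨ cong (λ i → φ^l α i ℓ) (+-comm j j₀) ⟩
            φ^l α (j₀ + j) ℓ        ≡⟨ φ^-+ α j₀ j [ ℓ ] ⟩
            φ^ α j₀ (φ^l α j ℓ)     ≡⟨ cong (φ^ α j₀) φʲℓ≡[] ⟩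
            φ^ α j₀ []              ≡⟨ φ^-[] α j₀ ⟩
            []                      ∎
      in case 0∷t≡[] of λ ()

    φ^-≢[] : ∀ j {w : Word (suc (suc k))} → w ≢ [] → φ^ α j w ≢ []
    φ^-≢[] j {[]} []≢[] = contradiction refl []≢[]
    φ^-≢[] j {x ∷ w} _ φʲ[x∷w]≡[] =
      φ^l-≢[] j x (++-conicalˡ (φ^l α j x) (φ^ α j w) (trans (sym (φ^-++ α j [ x ] w)) φʲ[x∷w]≡[]))

    n<U : ∀ n → n < U α n
    n<U zero = s≤s z≤n
    n<U (suc n) = ≤-<-trans (n<U n) (subst (U α n <_) (sym U[1+n]≡) (m<m+n (U α n) (≢[]⇒0<length tail≢[])))
      where
      U[1+n]≡ : U α (suc n) ≡ U α n + length (φ^ α n φ-zero-tail)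
      U[1+n]≡ = trans (cong length (φ^l-zero-suc n)) (length-++ (φ^l α n zero))
      tail≢[] : φ^ α n φ-zero-tail ≢ []
      tail≢[] = φ^-≢[] n (λ eq → case ++-conicalʳ (replicate (pred (α zero)) zero) [ suc zero ] eq of λ ())

module Blocks {k : ℕ} (α : Fin (suc (suc k)) → ℕ) (α₀≥1 : 1 ≤ α zero)
  (j₀ : ℕ) (starts₀ : ∀ ℓ → StartsWith0 (φ^l α j₀ ℓ)) {n K₀ : ℕ} (K₀≤n : K₀ ≤ n) (n≤U[K₀] : n ≤ U α K₀) where

  block : Fin (suc (suc k)) → Word (suc (suc k))
  block = φ^l α (K₀ + j₀)

  P X : Word (suc (suc k))
  P = uPref α n
  X = φ^l α K₀ zero

  P≡take : P ≡ take n X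
  P≡take = uPref≡take α α₀≥1 K₀≤n n≤U[K₀]

  ∣P∣≡n : length P ≡ n
  ∣P∣≡n = trans (cong length P≡take) (trans (length-take n X) (m≤n⇒m⊓n≡m n≤U[K₀]))

  block≡P++ : ∀ ℓ → ∃ λ s → block ℓ ≡ P ++ s
  block≡P++ ℓ =
    let (r , φʲ⁰ℓ≡0∷r) = startsWith0⇒∷ (starts₀ ℓ)
    in drop n X ++ φ^ α K₀ r , (begin
      φ^l α (K₀ + j₀) ℓ               ≡⟨ φ^-+ α K₀ j₀ [ ℓ ] ⟩
      φ^ α K₀ (φ^l α j₀ ℓ)            ≡⟨ cong (φ^ α K₀) φʲ⁰ℓ≡0∷r ⟩
      φ^ α K₀ (zero ∷ r)              ≡⟨ φ^-++ α K₀ [ zero ] r ⟩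
      X ++ φ^ α K₀ r                  ≡⟨ cong (_++ φ^ α K₀ r) X≡P++ ⟩
      (P ++ drop n X) ++ φ^ α K₀ r    ≡⟨ ++-assoc P (drop n X) (φ^ α K₀ r) ⟩
      P ++ drop n X ++ φ^ α K₀ r      ∎)
    where
    X≡P++ : X ≡ P ++ drop n X
    X≡P++ = trans (sym (take++drop≡id n X)) (cong (_++ drop n X) (sym P≡take))

  block-prefix : ∀ ℓ → block ℓ ≡ P ++ drop n (block ℓ)
  block-prefix ℓ =
    let (s , block≡P++s) = block≡P++ ℓ
    in trans block≡P++s (cong (P ++_) (sym (trans (cong (drop n) block≡P++s)
         (subst (λ i → drop i (P ++ s) ≡ s) ∣P∣≡n (drop-length-++ P s)))))

  rot-φ^ : ∀ {w} → w ≢ [] → rot α n (φ^ α (K₀ + j₀) w) ≡ concatMap (rot α n ∘ block) w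
  rot-φ^ {w} w≢[] = begin
    drop n (φ^ α (K₀ + j₀) w) ++ P                       ≡⟨ cong (λ u → drop n u ++ P) blocks ⟩
    drop n (concatMap (λ ℓ → P ++ b ℓ) w) ++ P           ≡⟨ cong (λ i → drop i (concatMap (λ ℓ → P ++ b ℓ) w) ++ P) ∣P∣≡n ⟨
    drop (length P) (concatMap (λ ℓ → P ++ b ℓ) w) ++ P  ≡⟨ rotate-concatMap P b w≢[] ⟩
    concatMap (rot α n ∘ block) w                        ∎
    where
    b : Fin (suc (suc k)) → Word (suc (suc k))
    b ℓ = drop n (block ℓ)
    blocks : φ^ α (K₀ + j₀) w ≡ concatMap (λ ℓ → P ++ b ℓ) w
    blocks = trans (φ^-concatMap α (K₀ + j₀) w) (concatMap-cong block-prefix w)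

  isDec-block : ∀ ℓ → ∃ (IsDec (block ℓ) (rot α n (block ℓ)))
  isDec-block ℓ = isDec-exists (subst (_∼ rot α n (block ℓ)) (sym (block-prefix ℓ)) (∼-++-comm P (drop n (block ℓ))))

  isDec-φ^ : ∀ {w Dℓ} → w ≢ [] → (∀ ℓ → IsDec (block ℓ) (rot α n (block ℓ)) (Dℓ ℓ)) →
    IsDec (φ^ α (K₀ + j₀) w) (rot α n (φ^ α (K₀ + j₀) w)) (concatMap Dℓ w)
  isDec-φ^ {w} w≢[] isDec-Dℓ =
    subst₂ (λ u ũ → IsDec u ũ _) (sym (φ^-concatMap α (K₀ + j₀) w)) (sym (rot-φ^ w≢[])) (isDec-concatMap w isDec-Dℓ)

proposition1 : (k : ℕ) (α : Fin (suc (suc k)) → ℕ) →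
    1 ≤ α zero → (∀ ℓ → α ℓ ≤ α zero) →
    (j₀ : ℕ) → (∀ ℓ → StartsWith0 (φ^l α j₀ ℓ)) →
    (∀ j → j < j₀ → ¬ (∀ ℓ → StartsWith0 (φ^l α j ℓ))) →
    (n : ℕ) → 1 ≤ n → (K : ℕ) → n ≤ U α K →
    (K₀ : ℕ) → n ≤ U α K₀ → (∀ K' → K' < K₀ → ¬ (n ≤ U α K')) →
    let R = suc k + j₀ in
    let v = φ^l α (K + R) zero in
    let vℓ = λ ℓ → φ^l α (K₀ + j₀) ℓ in
    (∃ λ D → IsDec v (rot α n v) D) ×
    (∀ ℓ → ∃ λ D → IsDec (vℓ ℓ) (rot α n (vℓ ℓ)) D) ×
    (∀ (D : List (Pair (suc (suc k)))) (Dℓ : Fin (suc (suc k)) → List (Pair (suc (suc k)))) →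
      IsDec v (rot α n v) D → (∀ ℓ → IsDec (vℓ ℓ) (rot α n (vℓ ℓ)) (Dℓ ℓ)) →
      ∀ p → (p ∈ D) ⇔ (∃ λ ℓ → p ∈ Dℓ ℓ))
proposition1 k α α₀≥1 _ j₀ starts₀ _ n _ K n≤U[K] K₀ n≤U[K₀] K₀-least =
  (_ , isDec-v (proj₂ ∘ isDec-block)) , isDec-block ,
  λ D Dℓ isDec-D isDec-Dℓ p →
    subst (λ F → p ∈ F ⇔ (∃ λ ℓ → p ∈ Dℓ ℓ)) (isDec-unique (isDec-v isDec-Dℓ) isDec-D) (∈-concatMap⇔ Dℓ every-letter∈W)
  where
  K₀≤K : K₀ ≤ K
  K₀≤K = ≮⇒≥ (λ K<K₀ → K₀-least K K<K₀ n≤U[K])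
  K₀≤n : K₀ ≤ n
  K₀≤n = ≮⇒≥ (λ n<K₀ → K₀-least n n<K₀ (<⇒≤ (n<U α α₀≥1 j₀ starts₀ n)))
  open Blocks α α₀≥1 j₀ starts₀ K₀≤n n≤U[K₀]
  W v : Word (suc (suc k))
  W = φ^l α (K ∸ K₀ + suc k) zero
  v = φ^l α (K + (suc k + j₀)) zero
  v≡ : v ≡ φ^ α (K₀ + j₀) W
  v≡ = trans (cong (λ i → φ^l α i zero) exponent) (φ^-+ α (K₀ + j₀) (K ∸ K₀ + suc k) [ zero ])
    where
    exponent : K + (suc k + j₀) ≡ (K₀ + j₀) + (K ∸ K₀ + suc k)
    exponent = trans (cong (_+ (suc k + j₀)) (sym (m∸n+n≡m K₀≤K)))
      (solve 4 (λ d k₀ j s → (d :+ k₀) :+ (s :+ j) := (k₀ :+ j) :+ (d :+ s)) refl (K ∸ K₀) K₀ j₀ (suc k))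
  every-letter∈W : ∀ ℓ → ℓ ∈ W
  every-letter∈W ℓ = ∈-φ^l-zero α α₀≥1 (≤-trans (s≤s⁻¹ (toℕ<n ℓ)) (m≤n+m (suc k) (K ∸ K₀)))
  isDec-v : ∀ {Dℓ} → (∀ ℓ → IsDec (block ℓ) (rot α n (block ℓ)) (Dℓ ℓ)) → IsDec v (rot α n v) (concatMap Dℓ W)
  isDec-v isDec-Dℓ =
    subst (λ u → IsDec u (rot α n u) _) (sym v≡) (isDec-φ^ (φ^l-≢[] α α₀≥1 j₀ starts₀ (K ∸ K₀ + suc k) zero) isDec-Dℓ)
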